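{- For one VIPA of capacity $\mathrm{Cap}$ operating in elevator mode on a line $L=(v_0,\dots,v_n)$ of length $|L|$ with origin $v_0$, the online algorithm MAIN is $2\,\mathrm{Cap}\cdot|L|$-competitive with respect to minimizing the total tour length.
   Context: A request is $r_j=(t_j,x_j,y_j,z_j)$: released at time $t_j$ (and only then known to the online algorithm), with origin station $x_j$, destination station $y_j$ and $z_j$ passengers. The VIPA has capacity $\mathrm{Cap}$ and unit speed. A feasible transportation schedule is a tour starting and ending at the origin $v_0$ that carries every passenger from its origin to its destination, never serving a request before its release date; its total tour length is its length. In elevator mode the VIPA moves along the line and may change direction at any station (and may wait). Stations are ordered $v_0<v_1<\dots<v_n$ along the line. An online algorithm ALG is $c$-competitive if $ALG(\sigma)\le c\cdot OPT(\sigma)$ for every request sequence $\sigma$, where $OPT(\sigma)$ is the minimum total tour length of a feasible schedule computed with full knowledge of $\sigma$ in advance. Algorithm MAIN ("Move Away If Necessary"): the server starts at $s:=v_0$; let $\sigma'$ be the set of released but not yet served requests. While $\sigma'\ne\emptyset$: let $\sigma'_{up}$ be the requests in $\sigma'$ with $s\le x_j\le y_j$; if $\sigma'_{up}\neq\emptyset$, serve all requests (or up to $\mathrm{Cap}$ passengers) of $\sigma'_{up}$, moving away from $v_0$ to the furthest destination among them; otherwise let $\sigma'_{down}$ be the requests in $\sigma'$ with $x_j>y_j$ and serve all of them (or up to $\mathrm{Cap}$ passengers) while moving towards the origin; then update $s$ and $\sigma'$ (remove served requests, add newly released ones). -}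

module Defs where

open import Data.Bool using (Bool; true; false; if_then_else_; _∧_; not)
open import Data.Nat using (ℕ; zero; suc; _+_; _*_; _∸_; _≤_; _<_; _⊓_; _≤ᵇ_; _<ᵇ_; ∣_-_∣)
open import Data.Fin using (Fin; toℕ; fromℕ; inject₁) renaming (zero to fzero; suc to fsuc)
open import Data.List using (List; []; _∷_; _++_; length; lookup; foldr; partitionᵇ)
open import Data.Bool.ListAction using (any)
open import Data.List.Relation.Unary.All using (All)
open import Data.Product using (_×_; _,_; proj₁; proj₂)
open import Relation.Binary.PropositionalEquality using (_≡_)

-- Requests on a line with stations v₀ < v₁ < … < vₙ, indexed by Fin (suc n).
-- A request r = (t, x, y, z): release date t, origin x, destination y,
-- z passengers.

record Request (n : ℕ) : Set where
  constructor req
  field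
    t : ℕ
    x : Fin (suc n)
    y : Fin (suc n)
    z : ℕ
open Request public

sumFin : (k : ℕ) → (Fin k → ℕ) → ℕ
sumFin zero    f = 0
sumFin (suc k) f = f fzero + sumFin k (λ i → f (fsuc i))

-- Everything below is relative to a line (station positions `pos`,
-- pos v₀ = 0, unit speed) and a vehicle capacity Cap.

module Line (n : ℕ) (pos : Fin (suc n) → ℕ) (Cap : ℕ) where

  Station : Set
  Station = Fin (suc n)

  dist : Station → Station → ℕ
  dist a b = ∣ pos a - pos b ∣

  lineLength : ℕ
  lineLength = pos (fromℕ n)

  -- A schedule is a sequence of stops 0..m; at stop i the vehicle is at
  -- station (station i) at time (time i), where it may pick up / drop
  -- off passengers.  Moving between stops (possibly changing direction,
  -- possibly waiting) takes at least the distance.  Passengers of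
  -- request j are carried in "shipments": an amount picked up at stop
  -- `pick` (at xⱼ, not before tⱼ) and carried without interruption to
  -- stop `drop` (at yⱼ).

  record Shipment (m : ℕ) : Set where
    constructor shipment
    field
      amount : ℕ
      pick   : Fin (suc m)
      drop   : Fin (suc m)
  open Shipment public

  record Schedule (σ : List (Request n)) : Set where
    field
      m       : ℕ
      station : Fin (suc m) → Station
      time    : Fin (suc m) → ℕ
      ship    : Fin (length σ) → List (Shipment m)
  open Schedule public

  tourLength : {σ : List (Request n)} → Schedule σ → ℕ
  tourLength S = sumFin (m S) (λ i → dist (station S (inject₁ i)) (station S (fsuc i)))

  sumAmounts : {k : ℕ} → List (Shipment k) → ℕ
  sumAmounts = foldr (λ sh acc → amount sh + acc) 0

  -- number of passengers on board on the leg from stop i to stop i+1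
  load : {σ : List (Request n)} (S : Schedule σ) → Fin (m S) → ℕ
  load {σ} S i = sumFin (length σ) (λ j →
    foldr (λ sh acc →
      (if (toℕ (pick sh) ≤ᵇ toℕ i) ∧ (toℕ i <ᵇ toℕ (drop sh)) then amount sh else 0) + acc)
      0 (ship S j))

  record Feasible {σ : List (Request n)} (S : Schedule σ) : Set where
    field
      starts   : station S fzero ≡ fzero
      ends     : station S (fromℕ (m S)) ≡ fzero
      speed    : ∀ (i : Fin (m S)) →
                 time S (inject₁ i) + dist (station S (inject₁ i)) (station S (fsuc i)) ≤ time S (fsuc i)
      allMoved : ∀ (j : Fin (length σ)) → sumAmounts (ship S j) ≡ z (lookup σ j)
      valid    : ∀ (j : Fin (length σ)) → All (λ sh →
                   (toℕ (pick sh) < toℕ (drop sh)) ×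
                   (station S (pick sh) ≡ x (lookup σ j)) ×
                   (station S (drop sh) ≡ y (lookup σ j)) ×
                   (t (lookup σ j) ≤ time S (pick sh))) (ship S j)
      capacity : ∀ (i : Fin (m S)) → load S i ≤ Cap

  maxSt : Station → Station → Station
  maxSt a b = if toℕ a ≤ᵇ toℕ b then b else a

  minSt : Station → Station → Station
  minSt a b = if toℕ a ≤ᵇ toℕ b then a else b

  record State : Set where
    constructor st
    field
      now     : ℕ
      here    : Station
      future  : List (Request n)     -- not yet released requests
      pending : List (Request n)     -- σ' (z = remaining passengers)
  open State public

  release : ℕ → Station → List (Request n) → List (Request n) → State
  release T s f p =
    st T s (proj₂ (partitionᵇ (λ r → t r ≤ᵇ T) f)) (p ++ proj₁ (partitionᵇ (λ r → t r ≤ᵇ T) f))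

  -- load up to `b` passengers of the requests satisfying P (in list order,
  -- splitting a request if necessary); returns (served parts, remaining σ')
  batch : (Request n → Bool) → ℕ → List (Request n) → List (Request n) × List (Request n)
  batch P b [] = [] , []
  batch P b (r ∷ rs) with P r ∧ (0 <ᵇ b)
  ... | true  =
        let k   = z r ⊓ b
            res = batch P (b ∸ k) rs
        in (req (t r) (x r) (y r) k ∷ proj₁ res) ,
           (if k <ᵇ z r then req (t r) (x r) (y r) (z r ∸ k) ∷ proj₂ res else proj₂ res)
  ... | false =
        let res = batch P b rs in proj₁ res , (r ∷ proj₂ res)

  isUp : Station → Request n → Bool
  isUp s r = (toℕ s ≤ᵇ toℕ (x r)) ∧ (toℕ (x r) ≤ᵇ toℕ (y r))

  isDown : Request n → Bool
  isDown r = toℕ (y r) <ᵇ toℕ (x r)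

  -- one iteration of the while loop (σ' nonempty): (distance driven, new state)
  trip : ℕ → Station → List (Request n) → List (Request n) → ℕ × State
  trip T s f p =
    if any (isUp s) p then
      (let res  = batch (isUp s) Cap p
           d    = foldr (λ r a → maxSt (y r) a) s (proj₁ res)
           cost = dist s d
       in cost , release (T + cost) d f (proj₂ res))
    else if any isDown p then
      (let res  = batch isDown Cap p
           top  = foldr (λ r a → maxSt (x r) a) s (proj₁ res)
           bot  = foldr (λ r a → minSt (y r) a) top (proj₁ res)
           cost = dist s top + dist top bot
       in cost , release (T + cost) bot f (proj₂ res))
    else
      -- only requests x ≤ y with x below s remain: move down to the lowest origin
      (let tgt  = foldr (λ r a → minSt (x r) a) s p
           cost = dist s tgt
       in cost , release (T + cost) tgt f p)

  -- Runs S c : starting from state S, MAIN drives total distance c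
  -- (including the final return to v₀) until all requests are served.
  data Runs : State → ℕ → Set where
    finish : ∀ {T s} → Runs (st T s [] []) (dist s fzero)
    wait   : ∀ {T s r f c} →
             Runs (release (suc T) s (r ∷ f) []) c →
             Runs (st T s (r ∷ f) []) c
    serve  : ∀ {T s f r p c} →
             Runs (proj₂ (trip T s f (r ∷ p))) c →
             Runs (st T s f (r ∷ p)) (proj₁ (trip T s f (r ∷ p)) + c)

  initial : List (Request n) → State
  initial σ = release 0 fzero σ []

  MAINcost : List (Request n) → ℕ → Set
  MAINcost σ c = Runs (initial σ) c

-- A feasible schedule carries each passenger between two distinct stations, i.e. over at
-- least one leg of positive (integral) length, and never carries more than Cap passengers
-- on a leg; hence Cap · OPT(σ) is at least the total number of passengers of σ.
-- On the other side, every iteration of MAIN that serves somebody serves at least one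
-- passenger and drives at most 2|L| (up to the furthest destination, or up to the highest
-- origin and then down), and every other iteration only moves the server towards v₀.
-- So pos(s) + 2|L| · (passengers not yet delivered) is a potential that pays for the rest
-- of the run, and MAIN(σ) ≤ 2|L| · Σ zⱼ ≤ 2 Cap |L| · OPT(σ).
module Submission where

open import Defs
open import Data.Nat
  using (ℕ; zero; suc; _+_; _*_; _∸_; _⊓_; _≤_; _<_; z≤n; s≤s; s≤s⁻¹; z<s; _≤ᵇ_; _<ᵇ_; ∣_-_∣)
open import Data.Nat.Properties
open import Data.Nat.Solver using (module +-*-Solver)
open +-*-Solver using (solve; _:=_; _:*_; con)
open import Algebra.Properties.CommutativeSemigroup +-commutativeSemigroup
  using (interchange; x∙yz≈y∙xz; x∙yz≈zx∙y)
open import Data.Fin using (Fin; zero; toℕ; fromℕ; inject₁) renaming (_<_ to _<ᶠ_)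
open import Data.Fin using () renaming (zero to fzero; suc to fsuc)
import Data.Fin.Properties as Fin
open import Data.Bool.Base using (Bool; true; false; if_then_else_; _∧_; _∨_)
import Data.Bool.Base as Bool
open import Data.Bool.Properties using (T-≡; ∨-conicalˡ)
open import Data.Bool.ListAction using (any)
open import Data.List using (List; []; _∷_; _++_; length; lookup; foldr; partitionᵇ)
open import Data.List.Membership.Propositional.Properties using (∈-lookup)
open import Data.List.Relation.Unary.All using (All; []; _∷_)
import Data.List.Relation.Unary.All as All
open import Data.List.Relation.Unary.All.Properties using (++⁺)
open import Data.Product using (_×_; _,_; ∃; proj₁; proj₂; map₂)
open import Data.Sum using (inj₁; inj₂)
open import Data.Unit using (tt)
open import Data.Empty using (⊥-elim)
open import Function using (_∘_; Equivalence)
open import Relation.Binary using (tri<; tri≈; tri>)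
open import Relation.Binary.PropositionalEquality
  using (_≡_; _≢_; refl; sym; trans; cong; cong₂; subst; module ≡-Reasoning)

≤⇒≤ᵇ≡true : ∀ {m n} → m ≤ n → (m ≤ᵇ n) ≡ true
≤⇒≤ᵇ≡true = Equivalence.to T-≡ ∘ ≤⇒≤ᵇ

≤ᵇ≡false⇒> : ∀ {m n} → (m ≤ᵇ n) ≡ false → n < m
≤ᵇ≡false⇒> e = ≰⇒> (λ le → subst Bool.T e (≤⇒≤ᵇ le))

<ᵇ≡true⇒< : ∀ {m n} → (m <ᵇ n) ≡ true → m < n
<ᵇ≡true⇒< {m} {n} e = <ᵇ⇒< m n (subst Bool.T (sym e) tt)

<ᵇ≡false⇒≥ : ∀ {m n} → (m <ᵇ n) ≡ false → n ≤ m
<ᵇ≡false⇒≥ e = ≮⇒≥ (λ lt → subst Bool.T e (<⇒<ᵇ lt))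

if-elim : ∀ {A : Set} (P : A → Set) b {u v : A} →
  (b ≡ true → P u) → (b ≡ false → P v) → P (if b then u else v)
if-elim P true  on-true on-false = on-true refl
if-elim P false on-true on-false = on-false refl

*-if-comm : ∀ (b : Bool) m n → m * (if b then n else 0) ≡ n * (if b then m else 0)
*-if-comm true  m n = *-comm m n
*-if-comm false m n = trans (*-zeroʳ m) (sym (*-zeroʳ n))

m+n≤2*o : ∀ {m n o} → m ≤ o → n ≤ o → m + n ≤ 2 * o
m+n≤2*o {o = o} m≤o n≤o = +-mono-≤ m≤o (≤-trans n≤o (m≤m+n o 0))

sumFin-cong : ∀ k {f g : Fin k → ℕ} → (∀ i → f i ≡ g i) → sumFin k f ≡ sumFin k g
sumFin-cong zero    f≡g = refl
sumFin-cong (suc k) f≡g = cong₂ _+_ (f≡g fzero) (sumFin-cong k (f≡g ∘ fsuc))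

sumFin-mono : ∀ k {f g : Fin k → ℕ} → (∀ i → f i ≤ g i) → sumFin k f ≤ sumFin k g
sumFin-mono zero    f≤g = z≤n
sumFin-mono (suc k) f≤g = +-mono-≤ (f≤g fzero) (sumFin-mono k (f≤g ∘ fsuc))

sumFin-zero : ∀ k → sumFin k (λ _ → 0) ≡ 0
sumFin-zero zero    = refl
sumFin-zero (suc k) = sumFin-zero k

sumFin-+ : ∀ k (f g : Fin k → ℕ) → sumFin k (λ i → f i + g i) ≡ sumFin k f + sumFin k g
sumFin-+ zero    f g = refl
sumFin-+ (suc k) f g =
  trans (cong (f fzero + g fzero +_) (sumFin-+ k (f ∘ fsuc) (g ∘ fsuc)))
        (interchange (f fzero) (g fzero) _ _)

*-distribˡ-sumFin : ∀ k c (f : Fin k → ℕ) → c * sumFin k f ≡ sumFin k (λ i → c * f i)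
*-distribˡ-sumFin zero    c f = *-zeroʳ c
*-distribˡ-sumFin (suc k) c f =
  trans (*-distribˡ-+ c (f fzero) _) (cong (c * f fzero +_) (*-distribˡ-sumFin k c (f ∘ fsuc)))

sumFin-comm : ∀ k l (f : Fin k → Fin l → ℕ) →
  sumFin k (λ i → sumFin l (f i)) ≡ sumFin l (λ j → sumFin k (λ i → f i j))
sumFin-comm zero    l f = sym (sumFin-zero l)
sumFin-comm (suc k) l f =
  trans (cong (sumFin l (f fzero) +_) (sumFin-comm k l (f ∘ fsuc))) (sym (sumFin-+ l (f fzero) _))

-- Written as a single foldr, so that Defs.sumAmounts and Defs.Line.load unfold to it.
sumBy : {A : Set} → (A → ℕ) → List A → ℕ
sumBy w = foldr (λ a acc → w a + acc) 0

module _ {A : Set} where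

  sumBy-lookup : ∀ (w : A → ℕ) xs → sumBy w xs ≡ sumFin (length xs) (w ∘ lookup xs)
  sumBy-lookup w []       = refl
  sumBy-lookup w (a ∷ xs) = cong (w a +_) (sumBy-lookup w xs)

  sumBy-++ : ∀ (w : A → ℕ) xs ys → sumBy w (xs ++ ys) ≡ sumBy w xs + sumBy w ys
  sumBy-++ w []       ys = refl
  sumBy-++ w (a ∷ xs) ys = trans (cong (w a +_) (sumBy-++ w xs ys)) (sym (+-assoc (w a) _ _))

  sumBy-mono : ∀ {f g : A → ℕ} {xs} → All (λ a → f a ≤ g a) xs → sumBy f xs ≤ sumBy g xs
  sumBy-mono []           = z≤n
  sumBy-mono (fa≤ga ∷ le) = +-mono-≤ fa≤ga (sumBy-mono le)

  elem≤sumBy : ∀ (w : A → ℕ) xs → All (λ a → w a ≤ sumBy w xs) xs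
  elem≤sumBy w []       = []
  elem≤sumBy w (a ∷ xs) =
    m≤m+n (w a) _ ∷ All.map (λ le → ≤-trans le (m≤n+m _ (w a))) (elem≤sumBy w xs)

  *-distribˡ-sumBy : ∀ c (w : A → ℕ) xs → c * sumBy w xs ≡ sumBy (λ a → c * w a) xs
  *-distribˡ-sumBy c w []       = *-zeroʳ c
  *-distribˡ-sumBy c w (a ∷ xs) =
    trans (*-distribˡ-+ c (w a) _) (cong (c * w a +_) (*-distribˡ-sumBy c w xs))

  sumFin-sumBy-comm : ∀ k (w : A → Fin k → ℕ) xs →
    sumFin k (λ i → sumBy (λ a → w a i) xs) ≡ sumBy (λ a → sumFin k (w a)) xs
  sumFin-sumBy-comm k w []       = sumFin-zero k
  sumFin-sumBy-comm k w (a ∷ xs) =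
    trans (sumFin-+ k (w a) _) (cong (sumFin k (w a) +_) (sumFin-sumBy-comm k w xs))

  sumBy-partitionᵇ : ∀ (p : A → Bool) (w : A → ℕ) xs →
    let (ys , zs) = partitionᵇ p xs in sumBy w ys + sumBy w zs ≡ sumBy w xs
  sumBy-partitionᵇ p w []       = refl
  sumBy-partitionᵇ p w (a ∷ xs) with p a | partitionᵇ p xs | sumBy-partitionᵇ p w xs
  ... | true  | ys , zs | ih = trans (+-assoc (w a) _ _) (cong (w a +_) ih)
  ... | false | ys , zs | ih = trans (x∙yz≈y∙xz (sumBy w ys) (w a) _) (cong (w a +_) ih)

  All-partitionᵇ : ∀ (p : A → Bool) {P : A → Set} {xs} → All P xs →
    let (ys , zs) = partitionᵇ p xs in All P ys × All (λ a → P a × p a ≡ false) zs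
  All-partitionᵇ p []                 = [] , []
  All-partitionᵇ p {xs = a ∷ xs} (pa ∷ pxs) with p a in e | partitionᵇ p xs | All-partitionᵇ p pxs
  ... | true  | ys , zs | all-ys , all-zs = pa ∷ all-ys , all-zs
  ... | false | ys , zs | all-ys , all-zs = all-ys , (pa , e) ∷ all-zs

-- Leg i (from stop i to stop i+1) is travelled between stops a and b, as in Defs.Line.load.
between : ∀ {k m} → Fin k → Fin k → Fin m → Bool
between a b i = (toℕ a ≤ᵇ toℕ i) ∧ (toℕ i <ᵇ toℕ b)

<ᵇ-suc : ∀ m n → (m <ᵇ suc n) ≡ (m ≤ᵇ n)
<ᵇ-suc zero    n = refl
<ᵇ-suc (suc m) n = refl

∣-∣-≤-sum-legs : ∀ m (g : Fin (suc m) → ℕ) (a b : Fin (suc m)) → toℕ a < toℕ b →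
  ∣ g a - g b ∣ ≤ sumFin m (λ i → if between a b i then ∣ g (inject₁ i) - g (fsuc i) ∣ else 0)
∣-∣-≤-sum-legs (suc m) g fzero (fsuc fzero) _ = m≤m+n _ _
∣-∣-≤-sum-legs (suc m) g fzero (fsuc (fsuc b)) _ =
  ≤-trans (∣-∣-triangle (g fzero) (g (fsuc fzero)) (g (fsuc (fsuc b))))
          (+-monoʳ-≤ _ (∣-∣-≤-sum-legs m (g ∘ fsuc) fzero (fsuc b) z<s))
∣-∣-≤-sum-legs (suc m) g (fsuc a) (fsuc b) (s≤s a<b) =
  ≤-trans (∣-∣-≤-sum-legs m (g ∘ fsuc) a b a<b)
          (≤-reflexive (sumFin-cong m λ i →
            cong (λ c → if c ∧ (toℕ i <ᵇ toℕ b)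
                          then ∣ g (fsuc (inject₁ i)) - g (fsuc (fsuc i)) ∣ else 0)
                 (sym (<ᵇ-suc (toℕ a) (toℕ i)))))

module StrictPositions (n : ℕ) (pos : Fin (suc n) → ℕ)
  (pos-strict : ∀ (i j : Fin (suc n)) → toℕ i < toℕ j → pos i < pos j) where

  pos-mono : ∀ {a b} → toℕ a ≤ toℕ b → pos a ≤ pos b
  pos-mono {a} {b} a≤b with m≤n⇒m<n∨m≡n a≤b
  ... | inj₁ a<b = <⇒≤ (pos-strict a b a<b)
  ... | inj₂ a≡b rewrite Fin.toℕ-injective {i = a} {j = b} a≡b = ≤-refl

  pos-injective : ∀ {a b} → pos a ≡ pos b → a ≡ b
  pos-injective {a} {b} eq with Fin.<-cmp a b
  ... | tri< a<b _ _ = ⊥-elim (<-irrefl eq (pos-strict a b a<b))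
  ... | tri≈ _ a≡b _ = a≡b
  ... | tri> _ _ b<a = ⊥-elim (<-irrefl (sym eq) (pos-strict b a b<a))

  ∣pos-pos∣>0 : ∀ {a b} → a ≢ b → 0 < ∣ pos a - pos b ∣
  ∣pos-pos∣>0 a≢b = n≢0⇒n>0 (a≢b ∘ pos-injective ∘ ∣m-n∣≡0⇒m≡n)

  pos≤pos-last : ∀ a → pos a ≤ pos (fromℕ n)
  pos≤pos-last a = pos-mono (Fin.≤fromℕ a)

  ∣pos-pos∣≤pos-last : ∀ a b → ∣ pos a - pos b ∣ ≤ pos (fromℕ n)
  ∣pos-pos∣≤pos-last a b =
    ≤-trans (∣m-n∣≤m⊔n (pos a) (pos b)) (⊔-lub (pos≤pos-last a) (pos≤pos-last b))

  ∣pos-pos∣+pos : ∀ {a b} → toℕ b ≤ toℕ a → ∣ pos a - pos b ∣ + pos b ≡ pos a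
  ∣pos-pos∣+pos b≤a =
    trans (cong (_+ _) (m≤n⇒∣n-m∣≡n∸m (pos-mono b≤a))) (m∸n+n≡m (pos-mono b≤a))

module ScheduleBound (n : ℕ) (pos : Fin (suc n) → ℕ)
  (pos-strict : ∀ (i j : Fin (suc n)) → toℕ i < toℕ j → pos i < pos j) (Cap : ℕ) where
  open Line n pos Cap
  open StrictPositions n pos pos-strict

  module _ {σ : List (Request n)} (S : Schedule σ) where

    leg : Fin (m S) → ℕ
    leg i = dist (station S (inject₁ i)) (station S (fsuc i))

    carried : Shipment (m S) → Fin (m S) → ℕ
    carried sh i = if between (pick sh) (drop sh) i then amount sh else 0

    amount≤legs : ∀ (sh : Shipment (m S)) → toℕ (pick sh) < toℕ (drop sh) →
      station S (pick sh) ≢ station S (drop sh) →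
      amount sh ≤ sumFin (m S) (λ i → leg i * carried sh i)
    amount≤legs sh pick<drop stations≢ = begin
      amount sh
        ≡⟨ *-identityʳ _ ⟨
      amount sh * 1
        ≤⟨ *-monoʳ-≤ (amount sh) legs≥1 ⟩
      amount sh * sumFin (m S) (λ i → if on-route i then leg i else 0)
        ≡⟨ *-distribˡ-sumFin (m S) (amount sh) _ ⟩
      sumFin (m S) (λ i → amount sh * (if on-route i then leg i else 0))
        ≡⟨ sumFin-cong (m S) (λ i → *-if-comm (on-route i) (amount sh) (leg i)) ⟩
      sumFin (m S) (λ i → leg i * carried sh i)
        ∎
      where
      open ≤-Reasoning
      on-route : Fin (m S) → Bool
      on-route = between (pick sh) (drop sh)
      legs≥1 : 1 ≤ sumFin (m S) (λ i → if on-route i then leg i else 0)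
      legs≥1 = ≤-trans (∣pos-pos∣>0 stations≢)
                       (∣-∣-≤-sum-legs (m S) (pos ∘ station S) (pick sh) (drop sh) pick<drop)

    shipped-legs≡legs*load : sumFin (length σ) (λ j →
        sumBy (λ sh → sumFin (m S) (λ i → leg i * carried sh i)) (ship S j)) ≡
      sumFin (m S) (λ i → leg i * load S i)
    shipped-legs≡legs*load = begin
      sumFin N (λ j → sumBy (λ sh → sumFin M (λ i → leg i * carried sh i)) (ship S j))
        ≡⟨ sumFin-cong N (λ j → sumFin-sumBy-comm M (λ sh i → leg i * carried sh i) (ship S j)) ⟨
      sumFin N (λ j → sumFin M (λ i → sumBy (λ sh → leg i * carried sh i) (ship S j)))
        ≡⟨ sumFin-cong N (λ j → sumFin-cong M λ i →
             *-distribˡ-sumBy (leg i) (λ sh → carried sh i) (ship S j)) ⟨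
      sumFin N (λ j → sumFin M (λ i → leg i * sumBy (λ sh → carried sh i) (ship S j)))
        ≡⟨ sumFin-comm N M _ ⟩
      sumFin M (λ i → sumFin N (λ j → leg i * sumBy (λ sh → carried sh i) (ship S j)))
        ≡⟨ sumFin-cong M (λ i → *-distribˡ-sumFin N (leg i) _) ⟨
      sumFin M (λ i → leg i * load S i)
        ∎
      where
      open ≡-Reasoning
      N M : ℕ
      N = length σ
      M = m S

  passengers≤Cap*tourLength : ∀ (σ : List (Request n)) → All (λ r → x r ≢ y r) σ →
    (S : Schedule σ) → Feasible S → sumBy z σ ≤ Cap * tourLength S
  passengers≤Cap*tourLength σ x≢y S F = begin
    sumBy z σ
      ≡⟨ sumBy-lookup z σ ⟩
    sumFin N (z ∘ lookup σ)
      ≡⟨ sumFin-cong N (Feasible.allMoved F) ⟨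
    sumFin N (λ j → sumBy amount (ship S j))
      ≤⟨ sumFin-mono N (λ j → sumBy-mono (All.map (shipment-bound j) (Feasible.valid F j))) ⟩
    sumFin N (λ j → sumBy (λ sh → sumFin M (λ i → leg S i * carried S sh i)) (ship S j))
      ≡⟨ shipped-legs≡legs*load S ⟩
    sumFin M (λ i → leg S i * load S i)
      ≤⟨ sumFin-mono M (λ i → *-monoʳ-≤ (leg S i) (Feasible.capacity F i)) ⟩
    sumFin M (λ i → leg S i * Cap)
      ≡⟨ sumFin-cong M (λ i → *-comm (leg S i) Cap) ⟩
    sumFin M (λ i → Cap * leg S i)
      ≡⟨ *-distribˡ-sumFin M Cap (leg S) ⟨
    Cap * tourLength S
      ∎
    where
    open ≤-Reasoning
    N M : ℕ
    N = length σ
    M = m S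
    shipment-bound : ∀ j {sh} →
      (toℕ (pick sh) < toℕ (drop sh)) × (station S (pick sh) ≡ x (lookup σ j)) ×
      (station S (drop sh) ≡ y (lookup σ j)) × (t (lookup σ j) ≤ time S (pick sh)) →
      amount sh ≤ sumFin M (λ i → leg S i * carried S sh i)
    shipment-bound j {sh} (pick<drop , at-x , at-y , _) =
      amount≤legs S sh pick<drop λ same →
        All.lookup x≢y (∈-lookup j) (trans (sym at-x) (trans same at-y))

module MAINBound (n : ℕ) (pos : Fin (suc n) → ℕ) (pos-origin : pos fzero ≡ 0)
  (pos-strict : ∀ (i j : Fin (suc n)) → toℕ i < toℕ j → pos i < pos j)
  (Cap : ℕ) (Cap≥1 : 1 ≤ Cap) (horizon : ℕ) where
  open Line n pos Cap
  open StrictPositions n pos pos-strict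

  passengers : List (Request n) → ℕ
  passengers = sumBy z

  undelivered : State → ℕ
  undelivered S = passengers (future S) + passengers (pending S)

  potential : State → ℕ
  potential S = pos (here S) + 2 * lineLength * undelivered S

  idle : State → ℕ
  idle S = if any (isUp (here S)) (pending S) then 0 else 1

  rank : State → ℕ
  rank S = 2 * undelivered S + idle S

  -- Every trip lowers the rank, and waiting for a release advances the
  -- clock towards the horizon, which bounds all release dates.
  measure : State → ℕ
  measure S = rank S + (horizon ∸ now S)

  Positive : Request n → Set
  Positive r = 1 ≤ z r

  record Invariant (S : State) : Set where
    field
      future-positive  : All Positive (future S)
      pending-positive : All Positive (pending S)
      future-dated     : All (λ r → now S < t r × t r ≤ horizon) (future S)
  open Invariant

  idle≤1 : ∀ S → idle S ≤ 1
  idle≤1 S with any (isUp (here S)) (pending S)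
  ... | true  = z≤n
  ... | false = ≤-refl

  idle-head-upward : ∀ T s f r p → isUp s r ≡ true → idle (st T s f (r ∷ p)) ≡ 0
  idle-head-upward T s f r p upward rewrite upward = refl

  minSt-≤ˡ : ∀ a b → toℕ (minSt a b) ≤ toℕ a
  minSt-≤ˡ a b with toℕ a ≤ᵇ toℕ b in a≤ᵇb
  ... | true  = ≤-refl
  ... | false = <⇒≤ (≤ᵇ≡false⇒> a≤ᵇb)

  minSt-≤ʳ : ∀ a b → toℕ (minSt a b) ≤ toℕ b
  minSt-≤ʳ a b with toℕ a ≤ᵇ toℕ b in a≤ᵇb
  ... | true  = ≤ᵇ⇒≤ (toℕ a) (toℕ b) (Equivalence.from T-≡ a≤ᵇb)
  ... | false = ≤-refl

  foldr-minSt-≤ : ∀ (g : Request n → Station) s rs →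
    toℕ (foldr (λ r a → minSt (g r) a) s rs) ≤ toℕ s
  foldr-minSt-≤ g s []       = ≤-refl
  foldr-minSt-≤ g s (r ∷ rs) = ≤-trans (minSt-≤ʳ (g r) _) (foldr-minSt-≤ g s rs)

  undelivered-release : ∀ T s f p → undelivered (release T s f p) ≡ passengers f + passengers p
  undelivered-release T s f p = begin
    passengers later + passengers (p ++ due)
      ≡⟨ cong (passengers later +_) (sumBy-++ z p due) ⟩
    passengers later + (passengers p + passengers due)
      ≡⟨ x∙yz≈zx∙y (passengers later) (passengers p) (passengers due) ⟩
    passengers due + passengers later + passengers p
      ≡⟨ cong (_+ passengers p) (sumBy-partitionᵇ (λ r → t r ≤ᵇ T) z f) ⟩
    passengers f + passengers p
      ∎
    where
    open ≡-Reasoning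
    due later : List (Request n)
    due   = proj₁ (partitionᵇ (λ r → t r ≤ᵇ T) f)
    later = proj₂ (partitionᵇ (λ r → t r ≤ᵇ T) f)

  release-invariant : ∀ T s f p → All Positive f → All Positive p →
    All (λ r → t r ≤ horizon) f → Invariant (release T s f p)
  release-invariant T s f p f-positive p-positive f-dated = record
    { future-positive  = All.map proj₁ (proj₂ (All-partitionᵇ due? f-positive))
    ; pending-positive = ++⁺ p-positive (proj₁ (All-partitionᵇ due? f-positive))
    ; future-dated     = All.map (λ (t≤horizon , not-due) → ≤ᵇ≡false⇒> not-due , t≤horizon)
                                 (proj₂ (All-partitionᵇ due? f-dated))
    }
    where
    due? : Request n → Bool
    due? r = t r ≤ᵇ T

  batch-passengers : ∀ P b p →
    passengers (proj₁ (batch P b p)) + passengers (proj₂ (batch P b p)) ≡ passengers p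
  batch-passengers P b []       = refl
  batch-passengers P b (r ∷ rs) with P r ∧ (0 <ᵇ b)
  ... | false = trans (x∙yz≈y∙xz (passengers (proj₁ (batch P b rs))) (z r) _)
                      (cong (z r +_) (batch-passengers P b rs))
  ... | true with z r ⊓ b <ᵇ z r in split | batch-passengers P (b ∸ (z r ⊓ b)) rs
  ...   | true  | ih = trans (interchange (z r ⊓ b) _ (z r ∸ (z r ⊓ b)) _)
                              (cong₂ _+_ (m+[n∸m]≡n (m⊓n≤m (z r) b)) ih)
  ...   | false | ih = trans (+-assoc (z r ⊓ b) _ _)
                              (cong₂ _+_ (≤-antisym (m⊓n≤m (z r) b) (<ᵇ≡false⇒≥ split)) ih)

  batch-remaining-positive : ∀ P b {p} → All Positive p → All Positive (proj₂ (batch P b p))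
  batch-remaining-positive P b [] = []
  batch-remaining-positive P b {r ∷ rs} (r-positive ∷ rs-positive) with P r ∧ (0 <ᵇ b)
  ... | false = r-positive ∷ batch-remaining-positive P b rs-positive
  ... | true with z r ⊓ b <ᵇ z r in split
  ...   | true  = m<n⇒0<n∸m (<ᵇ≡true⇒< {z r ⊓ b} {z r} split)
                  ∷ batch-remaining-positive P (b ∸ (z r ⊓ b)) rs-positive
  ...   | false = batch-remaining-positive P (b ∸ (z r ⊓ b)) rs-positive

  batch-served-positive : ∀ P b {p} → any P p ≡ true → All Positive p → 1 ≤ b →
    1 ≤ passengers (proj₁ (batch P b p))
  batch-served-positive P (suc b) {r ∷ rs} some (r-positive ∷ rs-positive) _ with P r
  ... | true  = ≤-trans (⊓-glb r-positive z<s) (m≤m+n _ _)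
  ... | false = batch-served-positive P (suc b) some rs-positive z<s

  record TripBound (S : State) (result : ℕ × State) : Set where
    field
      invariant : Invariant (proj₂ result)
      cost      : proj₁ result + potential (proj₂ result) ≤ potential S
      clock     : now S ≤ now (proj₂ result)
      rank-<    : rank (proj₂ result) < rank S
  open TripBound

  rank-<-undelivered : ∀ {S S'} → undelivered S' < undelivered S → rank S' < rank S
  rank-<-undelivered {S} {S'} fewer = begin-strict
    2 * undelivered S' + idle S' ≤⟨ +-monoʳ-≤ _ (idle≤1 S') ⟩
    2 * undelivered S' + 1       <⟨ +-monoʳ-< _ ≤-refl ⟩
    2 * undelivered S' + 2       ≡⟨ +-comm _ 2 ⟩
    2 + 2 * undelivered S'       ≡⟨ *-suc 2 _ ⟨
    2 * suc (undelivered S')     ≤⟨ *-monoʳ-≤ 2 fewer ⟩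
    2 * undelivered S            ≤⟨ m≤m+n _ _ ⟩
    rank S                       ∎
    where open ≤-Reasoning

  serving-trip : ∀ S {served remaining} (d : ℕ) (h : Station) → Invariant S →
    passengers served + passengers remaining ≡ passengers (pending S) → 1 ≤ passengers served →
    All Positive remaining → d + pos h ≤ 2 * lineLength →
    TripBound S (d , release (now S + d) h (future S) remaining)
  serving-trip S {served} {remaining} d h inv split served≥1 remaining-positive d+h≤2L = record
    { invariant = release-invariant _ h (future S) remaining
                    (future-positive inv) remaining-positive (All.map proj₂ (future-dated inv))
    ; cost      = cost-bound
    ; clock     = m≤m+n (now S) d
    ; rank-<    = rank-<-undelivered {S} {S'} fewer
    }
    where
    S' : State
    S' = release (now S + d) h (future S) remaining
    fewer : undelivered S' < undelivered S
    fewer = subst (_< undelivered S) (sym (undelivered-release _ h (future S) remaining))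
              (+-monoʳ-< (passengers (future S))
                (subst (passengers remaining <_) split (+-monoˡ-≤ (passengers remaining) served≥1)))
    open ≤-Reasoning
    cost-bound : d + potential S' ≤ potential S
    cost-bound = begin
      d + (pos h + 2 * lineLength * undelivered S')
        ≡⟨ +-assoc d _ _ ⟨
      d + pos h + 2 * lineLength * undelivered S'
        ≤⟨ +-monoˡ-≤ _ d+h≤2L ⟩
      2 * lineLength + 2 * lineLength * undelivered S'
        ≡⟨ *-suc (2 * lineLength) _ ⟨
      2 * lineLength * suc (undelivered S')
        ≤⟨ *-monoʳ-≤ (2 * lineLength) fewer ⟩
      2 * lineLength * undelivered S
        ≤⟨ m≤n+m _ _ ⟩
      potential S
        ∎

  module _ (T : ℕ) (s : Station) (f : List (Request n)) (r : Request n) (p : List (Request n))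
           (inv : Invariant (st T s f (r ∷ p))) where

    private
      S : State
      S = st T s f (r ∷ p)

    upward-trip : any (isUp s) (r ∷ p) ≡ true →
      let served    = proj₁ (batch (isUp s) Cap (r ∷ p))
          remaining = proj₂ (batch (isUp s) Cap (r ∷ p))
          top       = foldr (λ r a → maxSt (y r) a) s served
      in TripBound S (dist s top , release (T + dist s top) top f remaining)
    upward-trip some-up =
      serving-trip S {served} (dist s top) top inv (batch-passengers (isUp s) Cap (r ∷ p))
        (batch-served-positive (isUp s) Cap some-up (pending-positive inv) Cap≥1)
        (batch-remaining-positive (isUp s) Cap (pending-positive inv))
        (m+n≤2*o (∣pos-pos∣≤pos-last s top) (pos≤pos-last top))
      where
      served : List (Request n)
      served = proj₁ (batch (isUp s) Cap (r ∷ p))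
      top : Station
      top = foldr (λ r a → maxSt (y r) a) s served

    downward-trip : any isDown (r ∷ p) ≡ true →
      let served    = proj₁ (batch isDown Cap (r ∷ p))
          remaining = proj₂ (batch isDown Cap (r ∷ p))
          top       = foldr (λ r a → maxSt (x r) a) s served
          bottom    = foldr (λ r a → minSt (y r) a) top served
          d         = dist s top + dist top bottom
      in TripBound S (d , release (T + d) bottom f remaining)
    downward-trip some-down =
      serving-trip S {served} (dist s top + dist top bottom) bottom inv
        (batch-passengers isDown Cap (r ∷ p))
        (batch-served-positive isDown Cap some-down (pending-positive inv) Cap≥1)
        (batch-remaining-positive isDown Cap (pending-positive inv))
        (≤-trans (≤-reflexive (trans (+-assoc (dist s top) _ _) (cong (dist s top +_) descent)))
                 (m+n≤2*o (∣pos-pos∣≤pos-last s top) (pos≤pos-last top)))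
      where
      served : List (Request n)
      served = proj₁ (batch isDown Cap (r ∷ p))
      top bottom : Station
      top    = foldr (λ r a → maxSt (x r) a) s served
      bottom = foldr (λ r a → minSt (y r) a) top served
      descent : dist top bottom + pos bottom ≡ pos top
      descent = ∣pos-pos∣+pos (foldr-minSt-≤ y top served)

    -- With no upward and no downward request left, the pending requests all start below
    -- the server; driving down to the lowest origin makes an upward request available.
    repositioning-trip : any (isUp s) (r ∷ p) ≡ false → any isDown (r ∷ p) ≡ false →
      let low = foldr (λ r a → minSt (x r) a) s (r ∷ p)
      in TripBound S (dist s low , release (T + dist s low) low f (r ∷ p))
    repositioning-trip no-up no-down = record
      { invariant = release-invariant _ low f (r ∷ p)
                      (future-positive inv) (pending-positive inv) (All.map proj₂ (future-dated inv))
      ; cost      = ≤-reflexive cost-exact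
      ; clock     = m≤m+n T (dist s low)
      ; rank-<    = rank-decreases
      }
      where
      low : Station
      low = foldr (λ r a → minSt (x r) a) s (r ∷ p)
      S' : State
      S' = release (T + dist s low) low f (r ∷ p)
      cost-exact : dist s low + potential S' ≡ potential S
      cost-exact = begin
        dist s low + (pos low + 2 * lineLength * undelivered S')
          ≡⟨ +-assoc (dist s low) _ _ ⟨
        dist s low + pos low + 2 * lineLength * undelivered S'
          ≡⟨ cong₂ (λ a q → a + 2 * lineLength * q) (∣pos-pos∣+pos (foldr-minSt-≤ x s (r ∷ p)))
                                                    (undelivered-release _ low f (r ∷ p)) ⟩
        potential S
          ∎
        where open ≡-Reasoning
      due : List (Request n)
      due = proj₁ (partitionᵇ (λ r → t r ≤ᵇ T + dist s low) f)
      r-upward : isUp low r ≡ true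
      r-upward = cong₂ _∧_ (≤⇒≤ᵇ≡true {toℕ low} (minSt-≤ˡ (x r) _))
                           (≤⇒≤ᵇ≡true {toℕ (x r)}
                             (<ᵇ≡false⇒≥ {toℕ (y r)} (∨-conicalˡ (isDown r) (any isDown p) no-down)))
      rank-decreases : rank S' < rank S
      rank-decreases = begin-strict
        rank S'
          ≡⟨ cong₂ _+_ (cong (2 *_) (undelivered-release _ low f (r ∷ p)))
                       (idle-head-upward (T + dist s low) low (future S') r (p ++ due) r-upward) ⟩
        2 * undelivered S + 0
          <⟨ +-monoʳ-< _ z<s ⟩
        2 * undelivered S + 1
          ≡⟨ cong (λ b → 2 * undelivered S + (if b then 0 else 1)) no-up ⟨
        rank S
          ∎
        where open ≤-Reasoning

    trip-bound : TripBound S (trip T s f (r ∷ p))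
    trip-bound =
      if-elim (TripBound S) (any (isUp s) (r ∷ p)) upward-trip λ no-up →
      if-elim (TripBound S) (any isDown (r ∷ p)) downward-trip (repositioning-trip no-up)

  waiting-invariant : ∀ T s r f →
    Invariant (st T s (r ∷ f) []) → Invariant (release (suc T) s (r ∷ f) [])
  waiting-invariant T s r f inv =
    release-invariant (suc T) s (r ∷ f) [] (future-positive inv) [] (All.map proj₂ (future-dated inv))

  waiting-measure-< : ∀ T s r f → Invariant (st T s (r ∷ f) []) →
    measure (release (suc T) s (r ∷ f) []) < measure (st T s (r ∷ f) [])
  waiting-measure-< T s r f inv with future-dated inv
  ... | (T<t , t≤horizon) ∷ _ =
    +-mono-≤-< (+-mono-≤ (≤-reflexive (cong (2 *_) (undelivered-release (suc T) s (r ∷ f) [])))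
                         (idle≤1 (release (suc T) s (r ∷ f) [])))
               (∸-monoʳ-< (n<1+n T) (≤-trans T<t t≤horizon))

  trip-measure-< : ∀ {S result} → TripBound S result → measure (proj₂ result) < measure S
  trip-measure-< bound = +-mono-<-≤ (rank-< bound) (∸-monoʳ-≤ horizon (clock bound))

  runs-exist : ∀ k S → Invariant S → measure S < k → ∃ (Runs S)
  runs-exist (suc k) (st T s []      [])      inv _   = _ , finish
  runs-exist (suc k) (st T s (r ∷ f) [])      inv m<k =
    map₂ wait (runs-exist k _ (waiting-invariant T s r f inv)
                              (<-≤-trans (waiting-measure-< T s r f inv) (s≤s⁻¹ m<k)))
  runs-exist (suc k) (st T s f       (r ∷ p)) inv m<k =
    let (c , run) = runs-exist k _ (invariant bound) (<-≤-trans (trip-measure-< bound) (s≤s⁻¹ m<k))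
    in _ , serve run
    where
    bound : TripBound (st T s f (r ∷ p)) (trip T s f (r ∷ p))
    bound = trip-bound T s f r p inv

  cost≤potential : ∀ {S c} → Runs S c → Invariant S → c ≤ potential S
  cost≤potential (finish {s = s}) _ =
    ≤-trans (≤-reflexive (trans (cong (λ o → ∣ pos s - o ∣) pos-origin) (∣-∣-identityʳ (pos s))))
            (m≤m+n _ _)
  cost≤potential (wait {T} {s} {r} {f} run) inv =
    ≤-trans (cost≤potential run (waiting-invariant T s r f inv))
            (≤-reflexive (cong (λ q → pos s + 2 * lineLength * q)
                               (undelivered-release (suc T) s (r ∷ f) [])))
  cost≤potential (serve {T} {s} {f} {r} {p} run) inv =
    ≤-trans (+-monoʳ-≤ _ (cost≤potential run (invariant bound))) (cost bound)
    where
    bound : TripBound (st T s f (r ∷ p)) (trip T s f (r ∷ p))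
    bound = trip-bound T s f r p inv

  initial-invariant : ∀ σ → All Positive σ → All (λ r → t r ≤ horizon) σ → Invariant (initial σ)
  initial-invariant σ σ-positive σ-dated = release-invariant 0 fzero σ [] σ-positive [] σ-dated

  MAIN-terminates : ∀ σ → All Positive σ → All (λ r → t r ≤ horizon) σ → ∃ (MAINcost σ)
  MAIN-terminates σ σ-positive σ-dated =
    runs-exist _ (initial σ) (initial-invariant σ σ-positive σ-dated) ≤-refl

  MAIN≤2*length*passengers : ∀ σ → All Positive σ → All (λ r → t r ≤ horizon) σ →
    ∀ c → MAINcost σ c → c ≤ 2 * lineLength * passengers σ
  MAIN≤2*length*passengers σ σ-positive σ-dated c run = begin
    c
      ≤⟨ cost≤potential run (initial-invariant σ σ-positive σ-dated) ⟩
    pos fzero + 2 * lineLength * undelivered (initial σ)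
      ≡⟨ cong₂ (λ o q → o + 2 * lineLength * q) pos-origin
               (trans (undelivered-release 0 fzero σ []) (+-identityʳ _)) ⟩
    2 * lineLength * passengers σ
      ∎
    where open ≤-Reasoning

theorem5 : (n : ℕ) (pos : Fin (suc n) → ℕ) → pos zero ≡ 0 →
           (∀ (i j : Fin (suc n)) → i <ᶠ j → pos i < pos j) →
           (Cap : ℕ) → 1 ≤ Cap →
           (σ : List (Request n)) →
           All (λ r → (1 ≤ Request.z r) × (Request.x r ≢ Request.y r)) σ →
           (∃ λ c → Line.MAINcost n pos Cap σ c) ×
           (∀ c → Line.MAINcost n pos Cap σ c →
              ∀ (S : Line.Schedule n pos Cap σ) → Line.Feasible n pos Cap S →
              c ≤ 2 * Cap * Line.lineLength n pos Cap * Line.tourLength n pos Cap S)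
theorem5 n pos pos-origin pos-strict Cap Cap≥1 σ valid =
  MAIN-terminates σ σ-positive σ-dated , competitive
  where
  open Line n pos Cap
  open MAINBound n pos pos-origin pos-strict Cap Cap≥1 (sumBy t σ)
  open ScheduleBound n pos pos-strict Cap
  σ-positive : All Positive σ
  σ-positive = All.map proj₁ valid
  σ-dated : All (λ r → t r ≤ sumBy t σ) σ
  σ-dated = elem≤sumBy t σ
  competitive : ∀ c → MAINcost σ c → ∀ S → Feasible S → c ≤ 2 * Cap * lineLength * tourLength S
  competitive c run S feasible = begin
    c
      ≤⟨ MAIN≤2*length*passengers σ σ-positive σ-dated c run ⟩
    2 * lineLength * sumBy z σ
      ≤⟨ *-monoʳ-≤ (2 * lineLength) (passengers≤Cap*tourLength σ (All.map proj₂ valid) S feasible) ⟩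
    2 * lineLength * (Cap * tourLength S)
      ≡⟨ solve 3 (λ l c τ → con 2 :* l :* (c :* τ) := con 2 :* c :* l :* τ) refl
               lineLength Cap (tourLength S) ⟩
    2 * Cap * lineLength * tourLength S
      ∎
    where open ≤-Reasoning
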